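{- Let $L:P\to[n]$ be a labeling of an $n$-element poset $P$. Let $F_0$ be the set of elements of $P$ that are frozen with respect to $L$, and let $F_1$ be the set of elements of $P$ that are frozen with respect to $\partial(L)$. If $L$ is not a linear extension of $P$, then $F_0$ is a proper subset of $F_1$.
   Context: A labeling of a finite $n$-element poset $P$ is a bijection $L:P\to[n]$; it is a linear extension if $L(x)\le L(y)$ whenever $x\le_P y$. An upper order ideal of $P$ is a subset $Q$ such that $x\in Q$ and $x\le_P x'$ imply $x'\in Q$. Given a labeling $L$, let $a$ be the largest integer in $\{0,\dots,n\}$ such that for every $j\in\{n-a+1,\dots,n\}$ the set $\{x\in P: j\le L(x)\le n\}$ is an upper order ideal of $P$; an element $x$ is frozen with respect to $L$ if $n-a+1\le L(x)\le n$. For a labeling $L$ and a non-maximal $x\in P$, the $L$-successor of $x$ is the element $y>_P x$ minimizing $L(y)$. The promotion chain of $L$ is $v_1<_P\cdots<_P v_m$, where $v_1=L^{ -1}(1)$, $v_{i+1}$ is the $L$-successor of $v_i$ as long as $v_i$ is not maximal, and $v_m$ is maximal. Extended promotion is defined by $\partial(L)(x)=L(x)-1$ if $x$ is not in the promotion chain, $\partial(L)(v_i)=L(v_{i+1})-1$ for $1\le i\le m-1$, and $\partial(L)(v_m)=n$. -}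

module Defs where

open import Data.Nat using (ℕ; zero; suc; _≤_; _∸_; _+_)
open import Data.Nat.Properties using () renaming (_≟_ to _≟ℕ_)
open import Data.Fin using (Fin)
open import Data.Fin.Properties using () renaming (_≟_ to _≟F_)
open import Data.List using (List; []; _∷_; filter; allFin)
open import Data.Maybe using (Maybe; just; nothing)
open import Data.Product using (Σ; _×_; ∃)
open import Relation.Nullary using (¬_; Dec; yes; no)
open import Relation.Nullary.Decidable using (_×-dec_; ¬?)
open import Relation.Binary.PropositionalEquality using (_≡_)
open import Relation.Binary.Structures using (IsDecPartialOrder)
open import Data.Nat using (_≤?_)

record FinPoset (n : ℕ) : Set₁ where
  field
    _≤P_ : Fin n → Fin n → Set
    isDecPartialOrder : IsDecPartialOrder _≡_ _≤P_
  open IsDecPartialOrder isDecPartialOrder public using () renaming (_≤?_ to _≤P?_)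

  _<P_ : Fin n → Fin n → Set
  x <P y = x ≤P y × ¬ (x ≡ y)

  _<P?_ : (x y : Fin n) → Dec (x <P y)
  x <P? y = (x ≤P? y) ×-dec ¬? (x ≟F y)

open FinPoset public

Labeling : ℕ → Set
Labeling n = Fin n → ℕ

IsLabeling : ∀ {n} → Labeling n → Set
IsLabeling {n} L =
  (∀ x → 1 ≤ L x × L x ≤ n)
  × (∀ x y → L x ≡ L y → x ≡ y)
  × (∀ k → 1 ≤ k → k ≤ n → ∃ λ x → L x ≡ k)

IsLinearExtension : ∀ {n} (P : FinPoset n) → Labeling n → Set
IsLinearExtension P L = ∀ x y → _≤P_ P x y → L x ≤ L y

UpperOrderIdeal : ∀ {n} (P : FinPoset n) → (Fin n → Set) → Set
UpperOrderIdeal P Q = ∀ x x′ → Q x → _≤P_ P x x′ → Q x′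

GoodTail : ∀ {n} (P : FinPoset n) → Labeling n → ℕ → Set
GoodTail {n} P L a =
  a ≤ n × (∀ j → n ∸ a + 1 ≤ j → j ≤ n →
             UpperOrderIdeal P (λ x → j ≤ L x × L x ≤ n))

Frozen : ∀ {n} (P : FinPoset n) → Labeling n → Fin n → Set
Frozen {n} P L x =
  Σ ℕ λ a → GoodTail P L a × (∀ b → GoodTail P L b → b ≤ a)
            × n ∸ a + 1 ≤ L x × L x ≤ n

-- element of a list minimising L (first one in case of ties; ties do not
-- occur for labelings)
minBy : ∀ {n} → Labeling n → List (Fin n) → Maybe (Fin n)
minBy L [] = nothing
minBy L (y ∷ ys) with minBy L ys
... | nothing = just y
... | just z with L y ≤? L z
...   | yes _ = just y
...   | no _ = just z

successor : ∀ {n} (P : FinPoset n) → Labeling n → Fin n → Maybe (Fin n)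
successor {n} P L x = minBy L (filter (λ y → _<P?_ P x y) (allFin n))

-- follow successors (fuel bounds the length; chains have length ≤ n)
chainFrom : ∀ {n} (P : FinPoset n) → Labeling n → ℕ → Fin n → List (Fin n)
chainFrom P L zero x = x ∷ []
chainFrom P L (suc f) x with successor P L x
... | nothing = x ∷ []
... | just y = x ∷ chainFrom P L f y

labelOne : ∀ {n} → Labeling n → Maybe (Fin n)
labelOne {n} L with filter (λ x → L x ≟ℕ 1) (allFin n)
... | [] = nothing
... | x ∷ _ = just x

promotionChain : ∀ {n} (P : FinPoset n) → Labeling n → List (Fin n)
promotionChain {n} P L with labelOne L
... | nothing = []
... | just v₁ = chainFrom P L n v₁

chainLabel′ : ∀ {n} → Labeling n → Fin n → List (Fin n) → Fin n → Maybe ℕ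
chainLabel′ {n} L v [] x with x ≟F v
... | yes _ = just n
... | no _ = nothing
chainLabel′ L v (w ∷ ws) x with x ≟F v
... | yes _ = just (L w ∸ 1)
... | no _ = chainLabel′ L w ws x

chainLabel : ∀ {n} → Labeling n → List (Fin n) → Fin n → Maybe ℕ
chainLabel L [] x = nothing
chainLabel L (v ∷ vs) x = chainLabel′ L v vs x

∂ : ∀ {n} (P : FinPoset n) → Labeling n → Labeling n
∂ P L x with chainLabel L (promotionChain P L) x
... | just k = k
... | nothing = L x ∸ 1

-- Let a be the length of the frozen tail of L, so that F₀ consists of the labels above n ∸ a.
-- Inside that upper ideal ∂ lowers labels by at most one, since a chain element takes the label
-- of its successor, which lies in the ideal as well. Conversely, if ∂(L)(x) ≥ n ∸ a then every
-- strict upper bound of x has L-label above n ∸ a: off the chain by the ideal property, on the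
-- chain by minimality of the L-successor. Together, ∂(L) has a frozen tail of length at least
-- a + 1, so F₀ ⊆ F₁. As L is not a linear extension, a < n, and the promotion chain starts at
-- label 1 ≤ n ∸ a; at its last element x with L(x) ≤ n ∸ a the label jumps to the next chain
-- label minus one (or to n), so ∂(L)(x) ≥ n ∸ a and x ∈ F₁ ∖ F₀.
module Submission where

open import Defs
open import Data.Nat using (ℕ; zero; suc; _≤_; _<_; _∸_; _+_; z≤n; s≤s; s≤s⁻¹; _≤?_)
open import Data.Nat.Properties
  using (≤-refl; ≤-reflexive; ≤-trans; ≤-antisym; <⇒≤; ≰⇒>; ≤∧≢⇒<; <-≤-trans; n≮0; m≤n⇒m≤1+n;
         +-comm; +-monoˡ-≤; m≤n+m; m∸n≤m; m<n⇒0<n∸m; n∸n≡0; ∸-monoʳ-≤; module ≤-Reasoning; m+1+n≰m; allUpTo?)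
  renaming (_≟_ to _≟ℕ_)
open import Data.Fin using (Fin)
open import Data.Fin.Properties using (all?) renaming (_≟_ to _≟F_)
open import Data.List using ([]; _∷_; filter; allFin; length)
open import Data.List.Properties using (length-filter; length-tabulate)
open import Data.List.Membership.Propositional using (_∈_)
open import Data.List.Membership.Propositional.Properties using (∈-filter⁺; ∈-filter⁻; ∈-allFin)
open import Data.List.Relation.Unary.Any using (here; there)
open import Data.Maybe using (Maybe; just; nothing)
open import Data.Product using (Σ; _×_; ∃; _,_; proj₁; proj₂)
open import Relation.Nullary using (¬_; Dec; yes; no; contradiction)
open import Relation.Nullary.Decidable using (_×-dec_; _→-dec_; map′)
open import Relation.Unary using (Decidable)
open import Relation.Binary.PropositionalEquality using (_≡_; _≢_; refl; sym; trans; cong; subst)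
open import Relation.Binary.Structures using (IsDecPartialOrder)

∸-suc-unfold : ∀ {m a} → a < m → m ∸ a ≡ suc (m ∸ suc a)
∸-suc-unfold {suc m} {zero} _ = refl
∸-suc-unfold {suc m} {suc a} (s≤s a<m) = ∸-suc-unfold a<m

<⇒≤∸1 : ∀ {m k} → m < k → m ≤ k ∸ 1
<⇒≤∸1 (s≤s m≤k) = m≤k

≤∸1⇒< : ∀ {m k} → 1 ≤ m → m ≤ k ∸ 1 → m < k
≤∸1⇒< {k = zero} (s≤s _) ()
≤∸1⇒< {k = suc k} _ m≤k = s≤s m≤k

≤-suc-∸1 : ∀ m → m ≤ suc (m ∸ 1)
≤-suc-∸1 zero = z≤n
≤-suc-∸1 (suc m) = ≤-refl

+1≤suc⇒≤ : ∀ {m k} → m + 1 ≤ suc k → m ≤ k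
+1≤suc⇒≤ {m} {k} m+1≤k+1 = s≤s⁻¹ (subst (_≤ suc k) (+-comm m 1) m+1≤k+1)

threshold-suc : ∀ {m a j} → a < m → m ∸ suc a + 1 ≤ j → m ∸ a + 1 ≤ suc j
threshold-suc {m} {a} {j} a<m lo = begin
  m ∸ a + 1             ≡⟨ +-comm (m ∸ a) 1 ⟩
  suc (m ∸ a)           ≡⟨ cong suc (∸-suc-unfold a<m) ⟩
  suc (suc (m ∸ suc a)) ≡⟨ cong suc (+-comm 1 (m ∸ suc a)) ⟩
  suc (m ∸ suc a + 1)   ≤⟨ s≤s lo ⟩
  suc j                 ∎
  where open ≤-Reasoning

threshold-antitone : ∀ {m a a′} → a < m → suc a ≤ a′ → m ∸ a′ + 1 ≤ m ∸ a
threshold-antitone {m} {a} {a′} a<m a<a′ = begin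
  m ∸ a′ + 1      ≤⟨ +-monoˡ-≤ 1 (∸-monoʳ-≤ m a<a′) ⟩
  m ∸ suc a + 1   ≡⟨ +-comm (m ∸ suc a) 1 ⟩
  suc (m ∸ suc a) ≡⟨ sym (∸-suc-unfold a<m) ⟩
  m ∸ a           ∎
  where open ≤-Reasoning

module _ {n : ℕ} (L : Labeling n) where

  minBy-nothing : ∀ ys → minBy L ys ≡ nothing → ys ≡ []
  minBy-nothing [] _ = refl
  minBy-nothing (y ∷ ys) eq with minBy L ys
  ... | just z with L y ≤? L z
  minBy-nothing (y ∷ ys) () | just z | yes _
  minBy-nothing (y ∷ ys) () | just z | no _

  minBy-just : ∀ ys {z} → minBy L ys ≡ just z → z ∈ ys × (∀ {y} → y ∈ ys → L z ≤ L y)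
  minBy-just (y ∷ ys) eq with minBy L ys in e
  minBy-just (y ∷ ys) refl | nothing with refl ← minBy-nothing ys e = here refl , λ { (here refl) → ≤-refl }
  ... | just z with L y ≤? L z | minBy-just ys e
  minBy-just (y ∷ ys) refl | just z | yes y≤z | z∈ys , z-min =
    here refl , λ { (here refl) → ≤-refl ; (there w∈ys) → ≤-trans y≤z (z-min w∈ys) }
  minBy-just (y ∷ ys) refl | just z | no y≰z | z∈ys , z-min =
    there z∈ys , λ { (here refl) → <⇒≤ (≰⇒> y≰z) ; (there w∈ys) → z-min w∈ys }

module _ {A : Set} {p q : A → Set} (p? : Decidable p) (q? : Decidable q) (p⇒q : ∀ {a} → p a → q a) where

  length-filter-mono : ∀ xs → length (filter p? xs) ≤ length (filter q? xs)
  length-filter-mono [] = z≤n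
  length-filter-mono (x ∷ xs) with p? x | q? x
  ... | yes px | yes _ = s≤s (length-filter-mono xs)
  ... | yes px | no ¬qx = contradiction (p⇒q px) ¬qx
  ... | no _ | yes _ = m≤n⇒m≤1+n (length-filter-mono xs)
  ... | no _ | no _ = length-filter-mono xs

  length-filter-mono-< : ∀ {xs a} → a ∈ xs → q a → ¬ p a → length (filter p? xs) < length (filter q? xs)
  length-filter-mono-< {x ∷ xs} a∈xs qa ¬pa with p? x | q? x | a∈xs
  ... | yes px | no ¬qx | _ = contradiction (p⇒q px) ¬qx
  ... | yes px | yes _ | here refl = contradiction px ¬pa
  ... | yes _ | yes _ | there a∈ = s≤s (length-filter-mono-< a∈ qa ¬pa)
  ... | no _ | yes _ | here refl = s≤s (length-filter-mono xs)
  ... | no _ | yes _ | there a∈ = m≤n⇒m≤1+n (length-filter-mono-< a∈ qa ¬pa)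
  ... | no _ | no ¬qx | here refl = contradiction qa ¬qx
  ... | no _ | no _ | there a∈ = length-filter-mono-< a∈ qa ¬pa

module _ {Q : ℕ → Set} (Q? : Decidable Q) (Q0 : Q 0) where

  search-below : ∀ k → Σ ℕ λ a → Q a × (∀ b → Q b → b ≤ k → b ≤ a)
  search-below zero = 0 , Q0 , λ _ _ b≤0 → b≤0
  search-below (suc k) with Q? (suc k) | search-below k
  ... | yes Qk+1 | _ = suc k , Qk+1 , λ _ _ b≤k+1 → b≤k+1
  ... | no ¬Qk+1 | a , Qa , a-max = a , Qa , below
    where
    below : ∀ b → Q b → b ≤ suc k → b ≤ a
    below b Qb b≤k+1 with b ≟ℕ suc k
    ... | yes refl = contradiction Qb ¬Qk+1
    ... | no b≢k+1 with s≤s b≤k ← ≤∧≢⇒< b≤k+1 b≢k+1 = a-max b Qb b≤k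

  bounded-maximum : ∀ {k} → (∀ b → Q b → b ≤ k) → Σ ℕ λ a → Q a × (∀ b → Q b → b ≤ a)
  bounded-maximum {k} bounded with search-below k
  ... | a , Qa , a-max = a , Qa , λ b Qb → a-max b Qb (bounded b Qb)

module _ {n : ℕ} (P : FinPoset n) where

  open FinPoset P using () renaming (_≤P_ to _⊑_; _≤P?_ to _⊑?_; _<P_ to _⊏_; _<P?_ to _⊏?_)
  open IsDecPartialOrder (isDecPartialOrder P) using ()
    renaming (refl to ⊑-refl; trans to ⊑-trans; antisym to ⊑-antisym)

  ⊏-⊑-trans : ∀ {x y z} → x ⊏ y → y ⊑ z → x ⊏ z
  ⊏-⊑-trans (x⊑y , x≢y) y⊑z = ⊑-trans x⊑y y⊑z , λ { refl → x≢y (⊑-antisym x⊑y y⊑z) }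

  #above : Fin n → ℕ
  #above x = length (filter (x ⊏?_) (allFin n))

  #above≤n : ∀ x → #above x ≤ n
  #above≤n x = ≤-trans (length-filter (x ⊏?_) (allFin n)) (≤-reflexive (length-tabulate (λ y → y)))

  #above-< : ∀ {x y} → x ⊏ y → #above y < #above x
  #above-< x⊏y = length-filter-mono-< (_ ⊏?_) (_ ⊏?_) (λ y⊏z → ⊏-⊑-trans x⊏y (proj₁ y⊏z))
                   (∈-allFin _) x⊏y (λ y⊏y → proj₂ y⊏y refl)

  module _ (L : Labeling n) where

    successor-just : ∀ {x w} → successor P L x ≡ just w → x ⊏ w × (∀ {y} → x ⊏ y → L w ≤ L y)
    successor-just {x} e with w∈ , w-min ← minBy-just L (filter (x ⊏?_) (allFin n)) e =
      proj₂ (∈-filter⁻ (x ⊏?_) {xs = allFin n} w∈) , λ x⊏y → w-min (∈-filter⁺ (x ⊏?_) (∈-allFin _) x⊏y)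

    successor-nothing : ∀ {x y} → successor P L x ≡ nothing → ¬ x ⊏ y
    successor-nothing {x} {y} e x⊏y
      with () ← subst (y ∈_) (minBy-nothing L (filter (x ⊏?_) (allFin n)) e)
                             (∈-filter⁺ (x ⊏?_) (∈-allFin y) x⊏y)

    maximal⇒successor-nothing : ∀ {x} → (∀ {y} → ¬ x ⊏ y) → successor P L x ≡ nothing
    maximal⇒successor-nothing {x} maximal with successor P L x in e
    ... | nothing = refl
    ... | just w = contradiction (proj₁ (successor-just e)) maximal

    data PromotedLabel (x : Fin n) : ℕ → Set where
      to-successor : ∀ {w} → successor P L x ≡ just w → PromotedLabel x (L w ∸ 1)
      at-top       : successor P L x ≡ nothing → PromotedLabel x n

    data ChainLabelView (x : Fin n) : Maybe ℕ → Set where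
      off-chain : ChainLabelView x nothing
      on-chain  : ∀ {k} → PromotedLabel x k → ChainLabelView x (just k)

    chainLabel-skip : ∀ {v x} ws → x ≢ v → chainLabel L (v ∷ ws) x ≡ chainLabel L ws x
    chainLabel-skip {v} {x} [] x≢v with x ≟F v
    ... | yes x≡v = contradiction x≡v x≢v
    ... | no _ = refl
    chainLabel-skip {v} {x} (w ∷ ws) x≢v with x ≟F v
    ... | yes x≡v = contradiction x≡v x≢v
    ... | no _ = refl

    chainLabel-last : ∀ v → chainLabel L (v ∷ []) v ≡ just n
    chainLabel-last v with v ≟F v
    ... | yes _ = refl
    ... | no v≢v = contradiction refl v≢v

    chainLabel-cons : ∀ v y ws → chainLabel L (v ∷ y ∷ ws) v ≡ just (L y ∸ 1)
    chainLabel-cons v y ws with v ≟F v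
    ... | yes _ = refl
    ... | no v≢v = contradiction refl v≢v

    chainLabel-head : ∀ f v y → chainLabel L (v ∷ chainFrom P L f y) v ≡ just (L y ∸ 1)
    chainLabel-head zero v y = chainLabel-cons v y []
    chainLabel-head (suc f) v y with successor P L y
    ... | nothing = chainLabel-cons v y []
    ... | just z = chainLabel-cons v y (chainFrom P L f z)

    last-view : ∀ {v} → successor P L v ≡ nothing → ∀ x → ChainLabelView x (chainLabel L (v ∷ []) x)
    last-view {v} e x with x ≟F v
    ... | yes refl = on-chain (at-top e)
    ... | no _ = off-chain

    -- #above strictly decreases along the chain, so the fuel n of promotionChain never runs out
    -- before a maximal element is reached.
    chainFrom-view : ∀ f v → #above v ≤ f → ∀ x → ChainLabelView x (chainLabel L (chainFrom P L f v) x)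
    chainFrom-view zero v #v≤0 =
      last-view (maximal⇒successor-nothing (λ v⊏y → n≮0 (<-≤-trans (#above-< v⊏y) #v≤0)))
    chainFrom-view (suc f) v #v≤f+1 x with successor P L v in e
    ... | nothing = last-view e x
    ... | just y with x ≟F v
    ...   | yes refl = subst (ChainLabelView v) (sym (chainLabel-head f v y)) (on-chain (to-successor e))
    ...   | no x≢v = subst (ChainLabelView x) (sym (chainLabel-skip (chainFrom P L f y) x≢v))
                       (chainFrom-view f y #y≤f x)
      where #y≤f = s≤s⁻¹ (<-≤-trans (#above-< (proj₁ (successor-just e))) #v≤f+1)

    promotionChain-view : ∀ x → ChainLabelView x (chainLabel L (promotionChain P L) x)
    promotionChain-view x with labelOne L
    ... | nothing = off-chain
    ... | just v₁ = chainFrom-view n v₁ (#above≤n v₁) x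

    data ∂-View (x : Fin n) : ℕ → Set where
      off-chain : ∂-View x (L x ∸ 1)
      on-chain  : ∀ {k} → PromotedLabel x k → ∂-View x k

    ∂-view : ∀ x → ∂-View x (∂ P L x)
    ∂-view x with chainLabel L (promotionChain P L) x | promotionChain-view x
    ... | nothing | off-chain = off-chain
    ... | just _  | on-chain k = on-chain k

    labelOne-just : ∀ {x} → L x ≡ 1 → ∃ λ v → labelOne L ≡ just v × L v ≡ 1
    labelOne-just {x} Lx≡1 with filter (λ y → L y ≟ℕ 1) (allFin n) in eq
    ... | [] with () ← subst (x ∈_) eq (∈-filter⁺ (λ y → L y ≟ℕ 1) (∈-allFin x) Lx≡1)
    ... | v ∷ _ =
      v , refl , proj₂ (∈-filter⁻ (λ y → L y ≟ℕ 1) {xs = allFin n} (subst (v ∈_) (sym eq) (here refl)))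

    ∂-from-chainLabel : ∀ {v₁ x k} → labelOne L ≡ just v₁ → chainLabel L (chainFrom P L n v₁) x ≡ just k →
                        ∂ P L x ≡ k
    ∂-from-chainLabel one≡v₁ x↦k rewrite one≡v₁ | x↦k = refl

    chainFrom-crossing : ∀ {m} → m ≤ n → ∀ f v → L v ≤ m →
      ∃ λ x → v ⊑ x × L x ≤ m × ∃ λ k → chainLabel L (chainFrom P L f v) x ≡ just k × m ≤ k
    chainFrom-crossing m≤n zero v Lv≤m = v , ⊑-refl , Lv≤m , n , chainLabel-last v , m≤n
    chainFrom-crossing m≤n (suc f) v Lv≤m with successor P L v in e
    ... | nothing = v , ⊑-refl , Lv≤m , n , chainLabel-last v , m≤n
    ... | just y with L y ≤? _
    ...   | no Ly≰m = v , ⊑-refl , Lv≤m , L y ∸ 1 , chainLabel-head f v y , <⇒≤∸1 (≰⇒> Ly≰m)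
    ...   | yes Ly≤m with x , y⊑x , Lx≤m , k , x↦k , m≤k ← chainFrom-crossing m≤n f y Ly≤m =
              x , proj₁ v⊏x , Lx≤m , k , trans (chainLabel-skip (chainFrom P L f y) x≢v) x↦k , m≤k
      where
      v⊏x = ⊏-⊑-trans (proj₁ (successor-just e)) y⊑x
      x≢v : x ≢ v
      x≢v refl = proj₂ v⊏x refl

    ∂-crossing : IsLabeling L → ∀ {m} → 1 ≤ m → m ≤ n → ∃ λ x → L x ≤ m × m ≤ ∂ P L x
    ∂-crossing (_ , _ , onto) {m} 1≤m m≤n
      with x₁ , Lx₁≡1 ← onto 1 ≤-refl (≤-trans 1≤m m≤n)
      with v₁ , one≡v₁ , Lv₁≡1 ← labelOne-just Lx₁≡1
      with x , _ , Lx≤m , k , x↦k , m≤k ← chainFrom-crossing m≤n n v₁ (subst (_≤ m) (sym Lv₁≡1) 1≤m) =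
      x , Lx≤m , subst (m ≤_) (sym (∂-from-chainLabel one≡v₁ x↦k)) m≤k

    tail-ideal? : ∀ j → Dec (UpperOrderIdeal P (λ x → j ≤ L x × L x ≤ n))
    tail-ideal? j = all? λ x → all? λ x′ →
      ((j ≤? L x) ×-dec (L x ≤? n)) →-dec ((x ⊑? x′) →-dec ((j ≤? L x′) ×-dec (L x′ ≤? n)))

    goodTail? : ∀ a → Dec (GoodTail P L a)
    goodTail? a = map′ (λ (a≤n , ideal) → a≤n , λ j lo hi → ideal {j} (s≤s hi) lo)
                       (λ (a≤n , ideal) → a≤n , λ {j} j<n+1 lo → ideal j lo (s≤s⁻¹ j<n+1))
                       ((a ≤? n) ×-dec allUpTo? (λ j → (n ∸ a + 1 ≤? j) →-dec tail-ideal? j) (suc n))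

    goodTail-0 : GoodTail P L 0
    goodTail-0 = z≤n , λ j lo hi → contradiction (≤-trans lo hi) (m+1+n≰m n)

    MaximalGoodTail : ℕ → Set
    MaximalGoodTail a = GoodTail P L a × (∀ b → GoodTail P L b → b ≤ a)

    maximalGoodTail : Σ ℕ MaximalGoodTail
    maximalGoodTail = bounded-maximum goodTail? goodTail-0 (λ _ → proj₁)

    frozen⇒threshold : ∀ {a x} → MaximalGoodTail a → Frozen P L x → n ∸ a + 1 ≤ L x
    frozen⇒threshold {x = x} (ga , a-max) (b , gb , b-max , lo , _) =
      subst (λ c → n ∸ c + 1 ≤ L x) (≤-antisym (a-max b gb) (b-max _ ga)) lo

    threshold⇒frozen : ∀ {a x} → MaximalGoodTail a → n ∸ a + 1 ≤ L x → L x ≤ n → Frozen P L x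
    threshold⇒frozen {a} (ga , a-max) lo hi = a , ga , a-max , lo , hi

  module _ {L : Labeling n} (isLabeling : IsLabeling L) where

    label≤n : ∀ x → L x ≤ n
    label≤n x = proj₂ (proj₁ isLabeling x)

    ∂≤n : ∀ x → ∂ P L x ≤ n
    ∂≤n x = bounded (∂-view L x)
      where
      bounded : ∀ {c} → ∂-View L x c → c ≤ n
      bounded off-chain = ≤-trans (m∸n≤m (L x) 1) (label≤n x)
      bounded (on-chain (to-successor {w} _)) = ≤-trans (m∸n≤m (L w) 1) (label≤n w)
      bounded (on-chain (at-top _)) = ≤-refl

    tail-upward : ∀ {a k x x′} → GoodTail P L a → n ∸ a + 1 ≤ k → k ≤ L x → x ⊑ x′ → k ≤ L x′
    tail-upward (_ , ideal) lo k≤Lx x⊑x′ =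
      proj₁ (ideal _ lo (≤-trans k≤Lx (label≤n _)) _ _ (k≤Lx , label≤n _) x⊑x′)

    goodTail-n⇒linearExtension : GoodTail P L n → IsLinearExtension P L
    goodTail-n⇒linearExtension gn x y = tail-upward gn n∸n+1≤Lx ≤-refl
      where
      n∸n+1≤Lx : n ∸ n + 1 ≤ L x
      n∸n+1≤Lx = subst (λ c → c + 1 ≤ L x) (sym (n∸n≡0 n)) (proj₁ (proj₁ isLabeling x))

    ∂-tail-drop : ∀ {a k y} → GoodTail P L a → n ∸ a + 1 ≤ k → k ≤ L y → k ≤ suc (∂ P L y)
    ∂-tail-drop {y = y} ga lo k≤Ly = drop (∂-view L y)
      where
      drop : ∀ {c} → ∂-View L y c → _ ≤ suc c
      drop off-chain = ≤-trans k≤Ly (≤-suc-∸1 (L y))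
      drop (on-chain (to-successor {w} e)) =
        ≤-trans (tail-upward ga lo k≤Ly (proj₁ (proj₁ (successor-just L e)))) (≤-suc-∸1 (L w))
      drop (on-chain (at-top _)) = m≤n⇒m≤1+n (≤-trans k≤Ly (label≤n y))

    ∂-tail-lift : ∀ {a j x x′} → GoodTail P L a → a < n → n ∸ suc a + 1 ≤ j → x ⊏ x′ →
                  j ≤ ∂ P L x → suc j ≤ L x′
    ∂-tail-lift {a} {j} {x} {x′} ga a<n lo x⊏x′ = lift (∂-view L x)
      where
      1≤j : 1 ≤ j
      1≤j = ≤-trans (m≤n+m 1 (n ∸ suc a)) lo
      lift : ∀ {c} → ∂-View L x c → j ≤ c → suc j ≤ L x′
      lift off-chain j≤Lx∸1 = tail-upward ga (threshold-suc a<n lo) (≤∸1⇒< 1≤j j≤Lx∸1) (proj₁ x⊏x′)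
      lift (on-chain (to-successor e)) j≤Lw∸1 = ≤-trans (≤∸1⇒< 1≤j j≤Lw∸1) (proj₂ (successor-just L e) x⊏x′)
      lift (on-chain (at-top e)) _ = contradiction x⊏x′ (successor-nothing L e)

    ∂-goodTail-suc : ∀ {a} → GoodTail P L a → a < n → GoodTail P (∂ P L) (suc a)
    ∂-goodTail-suc {a} ga a<n = a<n , λ j lo _ x x′ (j≤∂x , _) x⊑x′ → upward lo x⊑x′ j≤∂x , ∂≤n x′
      where
      upward : ∀ {j x x′} → n ∸ suc a + 1 ≤ j → x ⊑ x′ → j ≤ ∂ P L x → j ≤ ∂ P L x′
      upward {x = x} {x′} lo x⊑x′ j≤∂x with x ≟F x′
      ... | yes refl = j≤∂x
      ... | no x≢x′ =
        s≤s⁻¹ (∂-tail-drop ga (threshold-suc a<n lo) (∂-tail-lift ga a<n lo (x⊑x′ , x≢x′) j≤∂x))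

lemma2p5 : ∀ {n} (P : FinPoset n) (L : Labeling n) → IsLabeling L →
    ¬ IsLinearExtension P L →
    (∀ x → Frozen P L x → Frozen P (∂ P L) x)
    × (∃ λ x → Frozen P (∂ P L) x × ¬ Frozen P L x)
lemma2p5 {n} P L isLabeling nonlinear = frozen-stays-frozen , newly-frozen
  where
  a = proj₁ (maximalGoodTail P L)
  max = proj₂ (maximalGoodTail P L)
  ga = proj₁ max
  a′ = proj₁ (maximalGoodTail P (∂ P L))
  max′ = proj₂ (maximalGoodTail P (∂ P L))

  a<n : a < n
  a<n = ≤∧≢⇒< (proj₁ ga) λ a≡n →
    nonlinear (goodTail-n⇒linearExtension P isLabeling (subst (GoodTail P L) a≡n ga))

  threshold-drops : n ∸ a′ + 1 ≤ n ∸ a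
  threshold-drops = threshold-antitone a<n (proj₂ max′ (suc a) (∂-goodTail-suc P isLabeling ga a<n))

  frozen-stays-frozen : ∀ x → Frozen P L x → Frozen P (∂ P L) x
  frozen-stays-frozen x frozen = threshold⇒frozen P (∂ P L) max′
    (≤-trans threshold-drops (+1≤suc⇒≤ (∂-tail-drop P isLabeling ga ≤-refl (frozen⇒threshold P L max frozen))))
    (∂≤n P isLabeling x)

  newly-frozen : ∃ λ x → Frozen P (∂ P L) x × ¬ Frozen P L x
  newly-frozen with x , Lx≤n∸a , n∸a≤∂x ← ∂-crossing P L isLabeling (m<n⇒0<n∸m a<n) (m∸n≤m n a) =
    x , threshold⇒frozen P (∂ P L) max′ (≤-trans threshold-drops n∸a≤∂x) (∂≤n P isLabeling x) ,
    λ frozen → m+1+n≰m (n ∸ a) (≤-trans (frozen⇒threshold P L max frozen) Lx≤n∸a)
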